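{- Let $p,q\in\mathbb{N}_0$, let $a_1,\dots,a_p,b_1,\dots,b_q$ be complex numbers with no $b_s$ equal to zero or a negative integer, let $k\in\mathbb{N}$, $m\in\mathbb{N}_0$, $n\in\mathbb{N}$, and $x\neq0$ real. With the notation $F_N$ defined in the context, $$n x^{n-1}F_{n-1}\!\left(a_1,\dots,a_p;b_1,\dots,b_q;\tfrac{m}{x^k}\right)=n x^{n-1}F_{n}\!\left(a_1,\dots,a_p;b_1,\dots,b_q;\tfrac{m}{x^k}\right)-k\,m\,\gamma_1\,\Delta_1(k,-n)\,x^{n-k-1}F_{n-k}\!\left(a_1+1,\dots,a_p+1;b_1+1,\dots,b_q+1;\tfrac{m}{x^k}\right),$$ where $\gamma_1=\frac{a_1a_2\cdots a_p}{b_1b_2\cdots b_q}$ and $\Delta_1(k,-n)=\prod_{j=1}^k\left(-\frac{n-j+1}{k}\right)$.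
   Context: $x^{(i)}$ denotes the rising factorial: $x^{(0)}=1$, $x^{(i)}=x(x+1)\cdots(x+i-1)$; empty products equal $1$. For an integer $N\ge0$ and parameters $c_1,\dots,c_p$, $d_1,\dots,d_q$ (no $d_s$ a nonpositive integer), define the terminating generalized hypergeometric sum $$F_N(c_1,\dots,c_p;d_1,\dots,d_q;z)={}_{p+k}F_q\Big[c_1,\dots,c_p,-\tfrac{N}{k},-\tfrac{N-1}{k},\dots,-\tfrac{N-k+1}{k};\,d_1,\dots,d_q\,\Big|\,z\Big]=\sum_{i=0}^{\lfloor N/k\rfloor}\frac{\prod_{r=1}^p c_r^{(i)}}{\prod_{s=1}^q d_s^{(i)}}\prod_{j=1}^k\left(-\frac{N-j+1}{k}\right)^{(i)}\frac{z^i}{i!},$$ and for $N<0$ set $F_N=0$ (in that case, i.e. $n<k$, the coefficient $\Delta_1(k,-n)$ vanishes anyway). -}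

module Defs where

open import Level using (Level; _⊔_) renaming (suc to lsuc)
open import Algebra.Bundles using (CommutativeRing)
open import Data.Nat as ℕ using (ℕ; zero; suc; NonZero; _!)
open import Data.Nat.DivMod using (_/_)
open import Data.Integer as ℤ using (ℤ; +_; -[1+_])
open import Data.Fin using (Fin; toℕ)
import Data.Fin as Fin
open import Relation.Nullary using (¬_)

ringℕ : ∀ {c ℓ} (R : CommutativeRing c ℓ) → ℕ → CommutativeRing.Carrier R
ringℕ R zero    = CommutativeRing.0# R
ringℕ R (suc n) = CommutativeRing._+_ R (CommutativeRing.1# R) (ringℕ R n)

-- A field of characteristic zero, presented as a commutative ring with a
-- total inverse function that is a genuine inverse on every nonzero element
-- (the value of 0⁻¹ is irrelevant and never used).  ℂ is an instance.
record CharZeroField (c ℓ : Level) : Set (lsuc (c ⊔ ℓ)) where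
  field
    commRing   : CommutativeRing c ℓ
  open CommutativeRing commRing public
  field
    _⁻¹        : Carrier → Carrier
    ⁻¹-inverse : ∀ x → ¬ (x ≈ 0#) → (x * (x ⁻¹)) ≈ 1#
    char-zero  : ∀ n → ¬ (ringℕ commRing (suc n) ≈ 0#)

module Ops {c ℓ : Level} (K : CharZeroField c ℓ) where
  open CharZeroField K

  ι : ℕ → Carrier
  ι = ringℕ commRing

  ιℤ : ℤ → Carrier
  ιℤ (+ n)     = ι n
  ιℤ -[1+ n ]  = - ι (suc n)

  _÷_ : Carrier → Carrier → Carrier
  x ÷ y = x * (y ⁻¹)

  _^_ : Carrier → ℕ → Carrier
  x ^ zero  = 1#
  x ^ suc n = x * (x ^ n)

  -- integer power (used only for x ≠ 0)
  _^ℤ_ : Carrier → ℤ → Carrier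
  x ^ℤ (+ n)    = x ^ n
  x ^ℤ -[1+ n ] = (x ⁻¹) ^ suc n

  ∏ : (n : ℕ) → (Fin n → Carrier) → Carrier
  ∏ zero    f = 1#
  ∏ (suc n) f = f Fin.zero * ∏ n (λ r → f (Fin.suc r))

  ∏< : ℕ → (ℕ → Carrier) → Carrier
  ∏< zero    f = 1#
  ∏< (suc i) f = ∏< i f * f i

  ∑≤ : ℕ → (ℕ → Carrier) → Carrier
  ∑≤ zero    f = f 0
  ∑≤ (suc M) f = ∑≤ M f + f (suc M)

  rising : Carrier → ℕ → Carrier
  rising x i = ∏< i (λ t → x + ι t)

  -- the j-th extra numerator parameter  -(N-j+1)/k   (j = 1..k)
  extraParam : ℕ → ℤ → ℕ → Carrier
  extraParam k N j = - (ιℤ ((N ℤ.- + j) ℤ.+ + 1) ÷ ι k)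

  Fℕ : (k : ℕ) .{{_ : NonZero k}} → (p q : ℕ) →
       (Fin p → Carrier) → (Fin q → Carrier) → ℕ → Carrier → Carrier
  Fℕ k p q cs ds N z =
    ∑≤ (N / k) (λ i →
        ((∏ p (λ r → rising (cs r) i) ÷ ∏ q (λ s → rising (ds s) i))
          * ∏ k (λ j → rising (extraParam k (+ N) (suc (toℕ j))) i))
        * ((z ^ i) ÷ ι (i !)))

  F : (k : ℕ) .{{_ : NonZero k}} → (p q : ℕ) →
      (Fin p → Carrier) → (Fin q → Carrier) → ℤ → Carrier → Carrier
  F k p q cs ds (+ N)    z = Fℕ k p q cs ds N z
  F k p q cs ds -[1+ N ] z = 0#

  γ₁ : (p q : ℕ) → (Fin p → Carrier) → (Fin q → Carrier) → Carrier
  γ₁ p q as bs = ∏ p as ÷ ∏ q bs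

  Δ₁ : ℕ → ℕ → Carrier
  Δ₁ k n = ∏ k (λ j → extraParam k (+ n) (suc (toℕ j)))

-- Write F_N(z) = Σ_i T_N(i) with T_N(i) = ratio(i) · E_N(i) · zⁱ/i!, where
-- ratio(i) = Π_r a_r^{(i)} / Π_s b_s^{(i)} and E_N(i) = Π_{j=1}^k e_N(j)^{(i)}
-- collects the extra parameters e_N(j) = -(N-j+1)/k.  The proof rests on
-- four facts:
--   * T_N(i) = 0 for i > ⌊N/k⌋, since e_N(N mod k + 1) = -⌊N/k⌋, so every
--     F_N may be summed over any longer range;
--   * ratio(i+1) = γ₁ · ratio'(i), where ' shifts all a_r, b_s by one;
--   * n (E_n(i+1) - E_{n-1}(i+1)) = k Δ₁(k,n) E_{n-k}(i) (i+1), because the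
--     parameters of F_{n-1} are those of F_n shifted by one place, and the
--     parameters of F_{n-k} are those of F_n raised by one;
--   * (i+1) z^{i+1}/(i+1)! = z · zⁱ/i!.
-- Summing gives n (F_n - F_{n-1}) = k γ₁ Δ₁(k,n) z F'_{n-k} (F-contiguous),
-- which at z = m/x^k together with x^{n-1}/x^k = x^{n-k-1} is the corollary.
module Submission where

open import Defs
open import Level using (Level)
open import Data.Nat using (ℕ; NonZero; _∸_)
open import Data.Integer using (+_) renaming (_-_ to _-ℤ_)
open import Data.Fin using (Fin)
open import Relation.Nullary using (¬_)

open import Data.Nat as ℕ using (zero; suc; _!)
import Data.Nat.Properties as ℕP
open import Data.Nat.DivMod using (_/_; _%_; m≡m%n+[m/n]*n; m%n<n; m/n≤m; m<n⇒m/n≡0)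
open import Data.Integer as ℤ using (ℤ; -[1+_])
import Data.Integer.Properties as ℤP
import Data.Sign as Sign
open import Data.Fin using (toℕ)
import Data.Fin as Fin
open import Data.Maybe using (Maybe; just; nothing)
open import Data.Product using (∃; _,_)
open import Data.Sum using (inj₁; inj₂)
open import Relation.Nullary using (yes; no)
open import Relation.Binary.PropositionalEquality as ≡ using (_≡_)
open import Algebra.Solver.Ring.AlmostCommutativeRing
  using (fromCommutativeRing; _-Raw-AlmostCommutative⟶_)
import Algebra.Solver.Ring as RingSolver
import Algebra.Properties.Ring as RingProperties
import Algebra.Properties.Semiring.Mult as SemiringMult
import Relation.Binary.Reasoning.Setoid as SetoidReasoning

sub-nonneg : ∀ {n k} → k ℕ.≤ n → + n -ℤ + k ≡ + (n ∸ k)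
sub-nonneg {n} {k} k≤n = ≡.trans (ℤP.m-n≡m⊖n n k) (ℤP.⊖-≥ k≤n)

sub-negative : ∀ {n k} → n ℕ.< k → ∃ λ j → + n -ℤ + k ≡ -[1+ j ]
sub-negative {n} {suc k} (ℕ.s≤s n≤k) =
  k ∸ n , ≡.trans (ℤP.m-n≡m⊖n n (suc k))
            (≡.trans (ℤP.⊖-< (ℕ.s≤s n≤k)) (≡.cong (λ t → ℤ.- (+ t)) (ℕP.+-∸-assoc 1 n≤k)))

module _ {c ℓ : Level} (K : CharZeroField c ℓ) where
  open CharZeroField K
  open Ops K
  open RingProperties ring
    using (-0#≈0#; -‿involutive; -‿+-comm; -‿distribˡ-*; -‿distribʳ-*; +-inverseˡ-unique)
  open SemiringMult semiring using (_×_; ×-homo-+; ×1-homo-*)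
  open SetoidReasoning setoid

  -- ℕ and ℤ map into K by the ring homomorphisms ι and ιℤ; ιℤ is what lets
  -- the ring solver (integer coefficients) work in K.

  ι≈× : ∀ n → ι n ≈ n × 1#
  ι≈× zero    = refl
  ι≈× (suc n) = +-congˡ (ι≈× n)

  ι-+ : ∀ a b → ι (a ℕ.+ b) ≈ ι a + ι b
  ι-+ a b = trans (ι≈× (a ℕ.+ b))
    (trans (×-homo-+ 1# a b) (sym (+-cong (ι≈× a) (ι≈× b))))

  ι-* : ∀ a b → ι (a ℕ.* b) ≈ ι a * ι b
  ι-* a b = trans (ι≈× (a ℕ.* b))
    (trans (×1-homo-* a b) (sym (*-cong (ι≈× a) (ι≈× b))))

  cancel-1+ : ∀ A B → (1# + A) - (1# + B) ≈ A - B
  cancel-1+ A B = begin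
    (1# + A) + - (1# + B)    ≈⟨ +-congˡ (-‿+-comm 1# B) ⟨
    (1# + A) + (- 1# + - B)  ≈⟨ +-assoc _ _ _ ⟩
    1# + (A + (- 1# + - B))  ≈⟨ +-congˡ (+-assoc _ _ _) ⟨
    1# + ((A + - 1#) + - B)  ≈⟨ +-congˡ (+-congʳ (+-comm _ _)) ⟩
    1# + ((- 1# + A) + - B)  ≈⟨ +-congˡ (+-assoc _ _ _) ⟩
    1# + (- 1# + (A + - B))  ≈⟨ +-assoc _ _ _ ⟨
    (1# + - 1#) + (A + - B)  ≈⟨ +-congʳ (-‿inverseʳ _) ⟩
    0# + (A + - B)           ≈⟨ +-identityˡ _ ⟩
    A + - B                  ∎

  ι-⊖ : ∀ a b → ιℤ (a ℤ.⊖ b) ≈ ι a - ι b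
  ι-⊖ a zero = begin
    ιℤ (a ℤ.⊖ 0)  ≡⟨ ≡.cong ιℤ (ℤP.⊖-≥ {a} {0} ℕ.z≤n) ⟩
    ι a           ≈⟨ +-identityʳ _ ⟨
    ι a + 0#      ≈⟨ +-congˡ -0#≈0# ⟨
    ι a - 0#      ∎
  ι-⊖ zero    (suc b) = sym (+-identityˡ _)
  ι-⊖ (suc a) (suc b) = begin
    ιℤ (suc a ℤ.⊖ suc b)   ≡⟨ ≡.cong ιℤ (ℤP.[1+m]⊖[1+n]≡m⊖n a b) ⟩
    ιℤ (a ℤ.⊖ b)           ≈⟨ ι-⊖ a b ⟩
    ι a - ι b              ≈⟨ cancel-1+ _ _ ⟨
    ι (suc a) - ι (suc b)  ∎

  ιℤ-neg : ∀ i → ιℤ (ℤ.- i) ≈ - ιℤ i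
  ιℤ-neg (+ zero)  = sym -0#≈0#
  ιℤ-neg (+ suc n) = refl
  ιℤ-neg -[1+ n ]  = sym (-‿involutive _)

  ιℤ-+ : ∀ i j → ιℤ (i ℤ.+ j) ≈ ιℤ i + ιℤ j
  ιℤ-+ (+ m)    (+ n)    = ι-+ m n
  ιℤ-+ (+ m)    -[1+ n ] = ι-⊖ m (suc n)
  ιℤ-+ -[1+ m ] (+ n)    = trans (ι-⊖ n (suc m)) (+-comm _ _)
  ιℤ-+ -[1+ m ] -[1+ n ] = begin
    - (1# + ι (suc (m ℕ.+ n)))  ≈⟨ -‿cong (+-congˡ (ι-+ (suc m) n)) ⟩
    - (1# + (ι (suc m) + ι n))  ≈⟨ -‿cong (+-assoc _ _ _) ⟨
    - ((1# + ι (suc m)) + ι n)  ≈⟨ -‿cong (+-congʳ (+-comm _ _)) ⟩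
    - ((ι (suc m) + 1#) + ι n)  ≈⟨ -‿cong (+-assoc _ _ _) ⟩
    - (ι (suc m) + ι (suc n))   ≈⟨ -‿+-comm _ _ ⟨
    - ι (suc m) + - ι (suc n)   ∎

  -- ℤ._*_ is computed as a sign applied to a natural number.
  ιℤ-+◃ : ∀ N → ιℤ (Sign.+ ℤ.◃ N) ≈ ι N
  ιℤ-+◃ zero    = refl
  ιℤ-+◃ (suc N) = refl

  ιℤ--◃ : ∀ N → ιℤ (Sign.- ℤ.◃ N) ≈ - ι N
  ιℤ--◃ zero    = sym -0#≈0#
  ιℤ--◃ (suc N) = refl

  ιℤ-* : ∀ i j → ιℤ (i ℤ.* j) ≈ ιℤ i * ιℤ j
  ιℤ-* (+ m)    (+ n)    = trans (ιℤ-+◃ (m ℕ.* n)) (ι-* m n)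
  ιℤ-* (+ m)    -[1+ n ] = trans (ιℤ--◃ (m ℕ.* suc n)) (trans (-‿cong (ι-* m (suc n))) (-‿distribʳ-* _ _))
  ιℤ-* -[1+ m ] (+ n)    = trans (ιℤ--◃ (suc m ℕ.* n)) (trans (-‿cong (ι-* (suc m) n)) (-‿distribˡ-* _ _))
  ιℤ-* -[1+ m ] -[1+ n ] = begin
    ιℤ (Sign.+ ℤ.◃ (suc m ℕ.* suc n))  ≈⟨ ιℤ-+◃ (suc m ℕ.* suc n) ⟩
    ι (suc m ℕ.* suc n)                ≈⟨ ι-* (suc m) (suc n) ⟩
    ι (suc m) * ι (suc n)              ≈⟨ -‿involutive _ ⟨
    - - (ι (suc m) * ι (suc n))        ≈⟨ -‿cong (-‿distribˡ-* _ _) ⟩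
    - (- ι (suc m) * ι (suc n))        ≈⟨ -‿distribʳ-* _ _ ⟩
    - ι (suc m) * - ι (suc n)          ∎

  ιℤ-morphism : ℤ.+-*-rawRing -Raw-AlmostCommutative⟶ fromCommutativeRing commRing
  ιℤ-morphism = record
    { ⟦_⟧ = ιℤ ; +-homo = ιℤ-+ ; *-homo = ιℤ-* ; -‿homo = ιℤ-neg
    ; 0-homo = refl ; 1-homo = +-identityʳ _ }

  ιℤ-≟ : ∀ i j → Maybe (ιℤ i ≈ ιℤ j)
  ιℤ-≟ i j with i ℤ.≟ j
  ... | yes i≡j = just (reflexive (≡.cong ιℤ i≡j))
  ... | no _    = nothing

  open RingSolver ℤ.+-*-rawRing (fromCommutativeRing commRing) ιℤ-morphism ιℤ-≟
    using (solve; con; _:+_; _:*_; _:-_; :-_; _:=_)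

  _≉0 : Carrier → Set ℓ
  x ≉0 = ¬ (x ≈ 0#)

  1≉0 : 1# ≉0
  1≉0 h = char-zero 0 (trans (+-identityʳ 1#) h)

  ι-≉0 : ∀ N → .{{NonZero N}} → ι N ≉0
  ι-≉0 (suc N) = char-zero N

  ≉0-resp : ∀ {u v} → u ≉0 → u ≈ v → v ≉0
  ≉0-resp u≉0 u≈v v≈0 = u≉0 (trans u≈v v≈0)

  *-≉0 : ∀ {u v} → u ≉0 → v ≉0 → (u * v) ≉0
  *-≉0 {u} {v} u≉0 v≉0 uv≈0 = u≉0 (begin
    u                 ≈⟨ *-identityʳ u ⟨
    u * 1#            ≈⟨ *-congˡ (⁻¹-inverse v v≉0) ⟨
    u * (v * v ⁻¹)    ≈⟨ *-assoc _ _ _ ⟨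
    (u * v) * v ⁻¹    ≈⟨ *-congʳ uv≈0 ⟩
    0# * v ⁻¹         ≈⟨ zeroˡ _ ⟩
    0#                ∎)

  ^-≉0 : ∀ {y} → y ≉0 → ∀ N → (y ^ N) ≉0
  ^-≉0 y≉0 zero    = 1≉0
  ^-≉0 y≉0 (suc N) = *-≉0 y≉0 (^-≉0 y≉0 N)

  ^-+ : ∀ y a b → y ^ (a ℕ.+ b) ≈ y ^ a * y ^ b
  ^-+ y zero    b = sym (*-identityˡ _)
  ^-+ y (suc a) b = trans (*-congˡ (^-+ y a b)) (sym (*-assoc _ _ _))

  ⁻¹-unique : ∀ {y w} → y ≉0 → y * w ≈ 1# → y ⁻¹ ≈ w
  ⁻¹-unique {y} {w} y≉0 yw≈1 = begin
    y ⁻¹               ≈⟨ *-identityʳ _ ⟨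
    y ⁻¹ * 1#          ≈⟨ *-congˡ yw≈1 ⟨
    y ⁻¹ * (y * w)     ≈⟨ solve 3 (λ y w y' → y' :* (y :* w) := (y :* y') :* w) refl y w (y ⁻¹) ⟩
    (y * y ⁻¹) * w     ≈⟨ *-congʳ (⁻¹-inverse y y≉0) ⟩
    1# * w             ≈⟨ *-identityˡ w ⟩
    w                  ∎

  ⁻¹-cong : ∀ {u v} → u ≉0 → u ≈ v → u ⁻¹ ≈ v ⁻¹
  ⁻¹-cong {u} {v} u≉0 u≈v = sym (⁻¹-unique (≉0-resp u≉0 u≈v)
    (trans (*-congʳ (sym u≈v)) (⁻¹-inverse u u≉0)))

  ⁻¹-* : ∀ {u v} → u ≉0 → v ≉0 → (u * v) ⁻¹ ≈ u ⁻¹ * v ⁻¹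
  ⁻¹-* {u} {v} u≉0 v≉0 = ⁻¹-unique (*-≉0 u≉0 v≉0) (begin
    (u * v) * (u ⁻¹ * v ⁻¹)    ≈⟨ solve 4 (λ u v u' v' → (u :* v) :* (u' :* v') := (u :* u') :* (v :* v'))
                                    refl u v (u ⁻¹) (v ⁻¹) ⟩
    (u * u ⁻¹) * (v * v ⁻¹)    ≈⟨ *-cong (⁻¹-inverse u u≉0) (⁻¹-inverse v v≉0) ⟩
    1# * 1#                    ≈⟨ *-identityˡ 1# ⟩
    1#                         ∎)

  ÷-interchange : ∀ {w y} u v → w ≉0 → y ≉0 → (u * v) ÷ (w * y) ≈ (u ÷ w) * (v ÷ y)
  ÷-interchange {w} {y} u v w≉0 y≉0 = begin
    (u * v) * (w * y) ⁻¹       ≈⟨ *-congˡ (⁻¹-* w≉0 y≉0) ⟩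
    (u * v) * (w ⁻¹ * y ⁻¹)    ≈⟨ solve 4 (λ u v w' y' → (u :* v) :* (w' :* y') := (u :* w') :* (v :* y'))
                                    refl u v (w ⁻¹) (y ⁻¹) ⟩
    (u ÷ w) * (v ÷ y)          ∎

  *-÷-cancel : ∀ {y} u → y ≉0 → y * (u ÷ y) ≈ u
  *-÷-cancel {y} u y≉0 = begin
    y * (u * y ⁻¹)    ≈⟨ solve 3 (λ y u y' → y :* (u :* y') := u :* (y :* y')) refl y u (y ⁻¹) ⟩
    u * (y * y ⁻¹)    ≈⟨ *-congˡ (⁻¹-inverse y y≉0) ⟩
    u * 1#            ≈⟨ *-identityʳ u ⟩
    u                 ∎

  ÷-*-cancel : ∀ {y} u → y ≉0 → (u * y) ÷ y ≈ u
  ÷-*-cancel {y} u y≉0 = trans (*-assoc _ _ _)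
    (trans (*-congˡ (⁻¹-inverse y y≉0)) (*-identityʳ u))

  ∏<-cong : ∀ i {f g : ℕ → Carrier} → (∀ t → f t ≈ g t) → ∏< i f ≈ ∏< i g
  ∏<-cong zero    f≈g = refl
  ∏<-cong (suc i) f≈g = *-cong (∏<-cong i f≈g) (f≈g i)

  ∏<-first : ∀ i (f : ℕ → Carrier) → ∏< (suc i) f ≈ f 0 * ∏< i (λ t → f (suc t))
  ∏<-first zero    f = trans (*-identityˡ _) (sym (*-identityʳ _))
  ∏<-first (suc i) f = trans (*-congʳ (∏<-first i f)) (*-assoc _ _ _)

  ∏<-* : ∀ i (f g : ℕ → Carrier) → ∏< i (λ t → f t * g t) ≈ ∏< i f * ∏< i g
  ∏<-* zero    f g = sym (*-identityˡ _)
  ∏<-* (suc i) f g = trans (*-congʳ (∏<-* i f g))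
    (solve 4 (λ A B a b → (A :* B) :* (a :* b) := (A :* a) :* (B :* b)) refl _ _ _ _)

  ∏<-zero : ∀ i (f : ℕ → Carrier) t → t ℕ.< i → f t ≈ 0# → ∏< i f ≈ 0#
  ∏<-zero (suc i) f t t<1+i ft≈0 with ℕP.m<1+n⇒m<n∨m≡n t<1+i
  ... | inj₁ t<i     = trans (*-congʳ (∏<-zero i f t t<i ft≈0)) (zeroˡ _)
  ... | inj₂ ≡.refl = trans (*-congˡ ft≈0) (zeroʳ _)

  ∏<-≉0 : ∀ i (f : ℕ → Carrier) → (∀ t → f t ≉0) → ∏< i f ≉0
  ∏<-≉0 zero    f f≉0 = 1≉0
  ∏<-≉0 (suc i) f f≉0 = *-≉0 (∏<-≉0 i f f≉0) (f≉0 i)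

  ∏-cong : ∀ r {f g : Fin r → Carrier} → (∀ t → f t ≈ g t) → ∏ r f ≈ ∏ r g
  ∏-cong zero    f≈g = refl
  ∏-cong (suc r) f≈g = *-cong (f≈g Fin.zero) (∏-cong r (λ t → f≈g (Fin.suc t)))

  ∏-* : ∀ r (f g : Fin r → Carrier) → ∏ r (λ t → f t * g t) ≈ ∏ r f * ∏ r g
  ∏-* zero    f g = sym (*-identityˡ _)
  ∏-* (suc r) f g = trans (*-congˡ (∏-* r _ _))
    (solve 4 (λ a b A B → (a :* b) :* (A :* B) := (a :* A) :* (b :* B)) refl _ _ _ _)

  ∏-≉0 : ∀ r (f : Fin r → Carrier) → (∀ t → f t ≉0) → ∏ r f ≉0
  ∏-≉0 zero    f f≉0 = 1≉0
  ∏-≉0 (suc r) f f≉0 = *-≉0 (f≉0 Fin.zero) (∏-≉0 r _ (λ t → f≉0 (Fin.suc t)))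

  ∏-toℕ : ∀ r (f : ℕ → Carrier) → ∏ r (λ j → f (toℕ j)) ≈ ∏< r f
  ∏-toℕ zero    f = refl
  ∏-toℕ (suc r) f = trans (*-congˡ (∏-toℕ r (λ t → f (suc t)))) (sym (∏<-first r f))

  ∑-cong : ∀ M {f g : ℕ → Carrier} → (∀ i → f i ≈ g i) → ∑≤ M f ≈ ∑≤ M g
  ∑-cong zero    f≈g = f≈g 0
  ∑-cong (suc M) f≈g = +-cong (∑-cong M f≈g) (f≈g (suc M))

  ∑-- : ∀ M (f g : ℕ → Carrier) → ∑≤ M (λ i → f i - g i) ≈ ∑≤ M f - ∑≤ M g
  ∑-- zero    f g = refl
  ∑-- (suc M) f g = trans (+-congʳ (∑-- M f g))
    (solve 4 (λ A B a b → (A :- B) :+ (a :- b) := (A :+ a) :- (B :+ b)) refl _ _ _ _)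

  ∑-*ˡ : ∀ M w (f : ℕ → Carrier) → w * ∑≤ M f ≈ ∑≤ M (λ i → w * f i)
  ∑-*ˡ zero    w f = refl
  ∑-*ˡ (suc M) w f = trans (distribˡ _ _ _) (+-congʳ (∑-*ˡ M w f))

  ∑-first : ∀ M (f : ℕ → Carrier) → ∑≤ (suc M) f ≈ f 0 + ∑≤ M (λ i → f (suc i))
  ∑-first zero    f = refl
  ∑-first (suc M) f = trans (+-congʳ (∑-first M f)) (+-assoc _ _ _)

  ∑-extend : ∀ L M (f : ℕ → Carrier) → L ℕ.≤ M → (∀ i → L ℕ.< i → f i ≈ 0#) → ∑≤ M f ≈ ∑≤ L f
  ∑-extend L M f L≤M f≈0 =
    ≡.subst (λ M' → ∑≤ M' f ≈ ∑≤ L f) (ℕP.m∸n+n≡m L≤M) (extend (M ∸ L))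
    where
    extend : ∀ e → ∑≤ (e ℕ.+ L) f ≈ ∑≤ L f
    extend zero    = refl
    extend (suc e) = trans (+-cong (extend e) (f≈0 _ (ℕ.s≤s (ℕP.m≤n+m L e)))) (+-identityʳ _)

  rising-cong : ∀ i {u v} → u ≈ v → rising u i ≈ rising v i
  rising-cong i u≈v = ∏<-cong i (λ t → +-congʳ u≈v)

  rising-first : ∀ i u → rising u (suc i) ≈ u * rising (u + 1#) i
  rising-first i u = trans (∏<-first i (λ t → u + ι t))
    (*-cong (+-identityʳ u) (∏<-cong i (λ t → sym (+-assoc u 1# (ι t)))))

  rising-zero : ∀ {u} i s → s ℕ.< i → u + ι s ≈ 0# → rising u i ≈ 0#
  rising-zero i s s<i us≈0 = ∏<-zero i _ s s<i us≈0

  NotNonPosInt : Carrier → Set ℓ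
  NotNonPosInt u = ∀ t → ¬ (u ≈ - ι t)

  NotNonPosInt-≉0 : ∀ {u} → NotNonPosInt u → u ≉0
  NotNonPosInt-≉0 u∉ℤ≤0 u≈0 = u∉ℤ≤0 0 (trans u≈0 (sym -0#≈0#))

  NotNonPosInt-+1 : ∀ {u} → NotNonPosInt u → NotNonPosInt (u + 1#)
  NotNonPosInt-+1 {u} u∉ℤ≤0 t u+1≈-t = u∉ℤ≤0 (suc t)
    (+-inverseˡ-unique u (ι (suc t)) (trans (sym (+-assoc _ _ _)) (begin
      (u + 1#) + ι t       ≈⟨ +-congʳ u+1≈-t ⟩
      - ι t + ι t          ≈⟨ -‿inverseˡ _ ⟩
      0#                   ∎)))

  rising-≉0 : ∀ {u} i → NotNonPosInt u → rising u i ≉0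
  rising-≉0 {u} i u∉ℤ≤0 = ∏<-≉0 i _ (λ t ut≈0 → u∉ℤ≤0 t (+-inverseˡ-unique u (ι t) ut≈0))

  module ExtraParameters (k' : ℕ) where

    k : ℕ
    k = suc k'

    e : ℕ → ℕ → Carrier
    e N = extraParam k (+ N)

    k·k⁻¹ : ι k * ι k ⁻¹ ≈ 1#
    k·k⁻¹ = ⁻¹-inverse (ι k) (char-zero k')

    e-closed : ∀ N j → e N j ≈ - (((ι N - ι j) + 1#) * ι k ⁻¹)
    e-closed N j = -‿cong (*-congʳ (begin
      ιℤ ((+ N ℤ.- + j) ℤ.+ + 1)      ≈⟨ ιℤ-+ (+ N ℤ.- + j) (+ 1) ⟩
      ιℤ (+ N ℤ.- + j) + (1# + 0#)    ≈⟨ +-cong (ιℤ-+ (+ N) (ℤ.- + j)) (+-identityʳ 1#) ⟩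
      (ι N + ιℤ (ℤ.- + j)) + 1#       ≈⟨ +-congʳ (+-congˡ (ιℤ-neg (+ j))) ⟩
      (ι N - ι j) + 1#                ∎))

    -- e_N(j+1) = -s when N = j + s k: the source of the termination of F_N.
    e-root : ∀ j s → e (j ℕ.+ s ℕ.* k) (suc j) + ι s ≈ 0#
    e-root j s = begin
      e (j ℕ.+ s ℕ.* k) (suc j) + ι s
        ≈⟨ +-congʳ (e-closed (j ℕ.+ s ℕ.* k) (suc j)) ⟩
      - (((ι (j ℕ.+ s ℕ.* k) - ι (suc j)) + 1#) * ι k ⁻¹) + ι s
        ≈⟨ +-congʳ (-‿cong (*-congʳ (+-congʳ (+-congʳ (trans (ι-+ j _) (+-congˡ (ι-* s k))))))) ⟩
      - ((((ι j + ι s * ι k) - (1# + ι j)) + 1#) * ι k ⁻¹) + ι s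
        ≈⟨ solve 5 (λ J S K' K⁻ one → :- ((((J :+ S :* K') :- (one :+ J)) :+ one) :* K⁻) :+ S
                                     := S :- S :* (K' :* K⁻))
             refl (ι j) (ι s) (ι k) (ι k ⁻¹) 1# ⟩
      ι s - ι s * (ι k * ι k ⁻¹)
        ≈⟨ +-congˡ (-‿cong (trans (*-congˡ k·k⁻¹) (*-identityʳ _))) ⟩
      ι s - ι s
        ≈⟨ -‿inverseʳ _ ⟩
      0# ∎

    e-shift : ∀ N j → e N (suc j) ≈ e (suc N) (suc (suc j))
    e-shift N j = begin
      e N (suc j)                                              ≈⟨ e-closed N (suc j) ⟩
      - (((ι N - (1# + ι j)) + 1#) * ι k ⁻¹)
        ≈⟨ solve 4 (λ N' J one K⁻ → :- (((N' :- (one :+ J)) :+ one) :* K⁻)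
                                 := :- ((((one :+ N') :- (one :+ (one :+ J))) :+ one) :* K⁻))
             refl (ι N) (ι j) 1# (ι k ⁻¹) ⟩
      - (((ι (suc N) - (1# + (1# + ι j))) + 1#) * ι k ⁻¹)      ≈⟨ e-closed (suc N) (suc (suc j)) ⟨
      e (suc N) (suc (suc j))                                  ∎

    e-wrap : ∀ N j → e N (j ℕ.+ k) ≈ e N j + 1#
    e-wrap N j = begin
      e N (j ℕ.+ k)                                             ≈⟨ e-closed N (j ℕ.+ k) ⟩
      - (((ι N - ι (j ℕ.+ k)) + 1#) * ι k ⁻¹)                   ≈⟨ -‿cong (*-congʳ (+-congʳ (+-congˡ (-‿cong (ι-+ j k))))) ⟩
      - (((ι N - (ι j + ι k)) + 1#) * ι k ⁻¹)
        ≈⟨ solve 5 (λ N' J K' one K⁻ → :- (((N' :- (J :+ K')) :+ one) :* K⁻)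
                                     := :- (((N' :- J) :+ one) :* K⁻) :+ K' :* K⁻)
             refl (ι N) (ι j) (ι k) 1# (ι k ⁻¹) ⟩
      - (((ι N - ι j) + 1#) * ι k ⁻¹) + ι k * ι k ⁻¹            ≈⟨ +-cong (sym (e-closed N j)) k·k⁻¹ ⟩
      e N j + 1#                                                ∎

    e-lower : ∀ N j → e N j ≈ e (N ℕ.+ k) j + 1#
    e-lower N j = begin
      e N j                                                     ≈⟨ e-closed N j ⟩
      - (((ι N - ι j) + 1#) * ι k ⁻¹)
        ≈⟨ solve 5 (λ N' J K' one K⁻ → :- (((N' :- J) :+ one) :* K⁻)
                                     := :- ((((N' :+ K') :- J) :+ one) :* K⁻) :+ K' :* K⁻)
             refl (ι N) (ι j) (ι k) 1# (ι k ⁻¹) ⟩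
      - ((((ι N + ι k) - ι j) + 1#) * ι k ⁻¹) + ι k * ι k ⁻¹
        ≈⟨ +-cong (-‿cong (*-congʳ (+-congʳ (+-congʳ (sym (ι-+ N k)))))) k·k⁻¹ ⟩
      - (((ι (N ℕ.+ k) - ι j) + 1#) * ι k ⁻¹) + 1#              ≈⟨ +-congʳ (e-closed (N ℕ.+ k) j) ⟨
      e (N ℕ.+ k) j + 1#                                        ∎

    e-first : ∀ N → ι N ≈ - (ι k * e N 1)
    e-first N = sym (begin
      - (ι k * e N 1)                                           ≈⟨ -‿cong (*-congˡ (e-closed N 1)) ⟩
      - (ι k * - (((ι N - (1# + 0#)) + 1#) * ι k ⁻¹))
        ≈⟨ solve 4 (λ N' K' one K⁻ → :- (K' :* :- (((N' :- (one :+ con (+ 0))) :+ one) :* K⁻))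
                                   := N' :* (K' :* K⁻))
             refl (ι N) (ι k) 1# (ι k ⁻¹) ⟩
      ι N * (ι k * ι k ⁻¹)                                      ≈⟨ *-congˡ k·k⁻¹ ⟩
      ι N * 1#                                                  ≈⟨ *-identityʳ _ ⟩
      ι N                                                       ∎)

  module Series (k' p q : ℕ) (z : Carrier) where
    open ExtraParameters k'

    ratio : (Fin p → Carrier) → (Fin q → Carrier) → ℕ → Carrier
    ratio cs ds i = ∏ p (λ r → rising (cs r) i) ÷ ∏ q (λ s → rising (ds s) i)

    extra : ℕ → ℕ → Carrier
    extra N i = ∏ k (λ j → rising (e N (suc (toℕ j))) i)

    power : ℕ → Carrier
    power i = (z ^ i) ÷ ι (i !)

    term : (Fin p → Carrier) → (Fin q → Carrier) → ℕ → ℕ → Carrier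
    term cs ds N i = (ratio cs ds i * extra N i) * power i

    -- Beyond ⌊N/k⌋ the factor e_N(N mod k + 1)^{(i)} vanishes.
    extra-vanishes : ∀ N i → N / k ℕ.< i → extra N i ≈ 0#
    extra-vanishes N i N/k<i = trans (∏-toℕ k (λ j → rising (e N (suc j)) i))
      (∏<-zero k _ (N % k) (m%n<n N k) (rising-zero i (N / k) N/k<i root))
      where
      root : e N (suc (N % k)) + ι (N / k) ≈ 0#
      root = ≡.subst (λ M → e M (suc (N % k)) + ι (N / k) ≈ 0#)
               (≡.sym (m≡m%n+[m/n]*n N k)) (e-root (N % k) (N / k))

    Fℕ-extend : ∀ cs ds N M → N / k ℕ.≤ M → Fℕ k p q cs ds N z ≈ ∑≤ M (term cs ds N)
    Fℕ-extend cs ds N M N/k≤M = sym (∑-extend (N / k) M (term cs ds N) N/k≤M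
      (λ i N/k<i → trans (*-congʳ (trans (*-congˡ (extra-vanishes N i N/k<i)) (zeroʳ _))) (zeroˡ _)))

    Fℕ-below-k : ∀ cs ds N → N ℕ.< k → Fℕ k p q cs ds N z ≡ term cs ds 0 0
    Fℕ-below-k cs ds N N<k = ≡.cong (λ M → ∑≤ M (term cs ds N)) (m<n⇒m/n≡0 N<k)

    ratio-step : ∀ a b → (∀ s → NotNonPosInt (b s)) → ∀ i →
      ratio a b (suc i) ≈ γ₁ p q a b * ratio (λ r → a r + 1#) (λ s → b s + 1#) i
    ratio-step a b b∉ℤ≤0 i = begin
      ∏ p (λ r → rising (a r) (suc i)) ÷ ∏ q (λ s → rising (b s) (suc i))
        ≈⟨ *-cong (split p a)
                  (⁻¹-cong (∏-≉0 q _ (λ s → rising-≉0 (suc i) (b∉ℤ≤0 s))) (split q b)) ⟩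
      (∏ p a * ∏ p (λ r → rising (a r + 1#) i)) ÷ (∏ q b * ∏ q (λ s → rising (b s + 1#) i))
        ≈⟨ ÷-interchange _ _ (∏-≉0 q b (λ s → NotNonPosInt-≉0 (b∉ℤ≤0 s)))
                             (∏-≉0 q _ (λ s → rising-≉0 i (NotNonPosInt-+1 (b∉ℤ≤0 s)))) ⟩
      γ₁ p q a b * ratio (λ r → a r + 1#) (λ s → b s + 1#) i
        ∎
      where
      split : ∀ r (cs : Fin r → Carrier) →
        ∏ r (λ t → rising (cs t) (suc i)) ≈ ∏ r cs * ∏ r (λ t → rising (cs t + 1#) i)
      split r cs = trans (∏-cong r (λ t → rising-first i (cs t))) (∏-* r _ _)

    extra-step : ∀ n' d → suc n' ≡ d ℕ.+ k → ∀ i →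
      ι (suc n') * (extra (suc n') (suc i) - extra n' (suc i))
        ≈ ((ι k * Δ₁ k (suc n')) * extra d i) * ι (suc i)
    extra-step n' d n≡d+k i = begin
      ι n * (extra n (suc i) - extra n' (suc i))
        ≈⟨ *-cong (e-first n) (+-cong top (-‿cong below)) ⟩
      - (ι k * g 0) * ((g 0 * ρ) * (D * R) - (D * R) * (ρ * ((g 0 + 1#) + ι i)))
        ≈⟨ solve 7 (λ K' g₀ ρ' D' R' one I →
                 :- (K' :* g₀) :* ((g₀ :* ρ') :* (D' :* R') :- (D' :* R') :* (ρ' :* ((g₀ :+ one) :+ I)))
                 := ((K' :* (g₀ :* D')) :* (ρ' :* R')) :* (one :+ I))
             refl (ι k) (g 0) ρ D R 1# (ι i) ⟩
      ((ι k * (g 0 * D)) * (ρ * R)) * (1# + ι i)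
        ≈⟨ *-congʳ (*-cong (*-congˡ (sym Δ-split)) (sym lowered)) ⟩
      ((ι k * Δ₁ k n) * extra d i) * ι (suc i)
        ∎
      where
      n : ℕ
      n = suc n'
      g : ℕ → Carrier
      g j = e n (suc j)
      ρ D R : Carrier
      ρ = rising (g 0 + 1#) i
      D = ∏< k' (λ j → g (suc j))
      R = ∏< k' (λ j → rising (g (suc j) + 1#) i)
      -- g 1, …, g k' occur in both E_n and E_{n-1}
      common : ∏< k' (λ j → rising (g (suc j)) (suc i)) ≈ D * R
      common = trans (∏<-cong k' (λ j → rising-first i (g (suc j)))) (∏<-* k' _ _)
      top : extra n (suc i) ≈ (g 0 * ρ) * (D * R)
      top = begin
        extra n (suc i)                                                   ≈⟨ ∏-toℕ k (λ j → rising (g j) (suc i)) ⟩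
        ∏< k (λ j → rising (g j) (suc i))                                 ≈⟨ ∏<-first k' _ ⟩
        rising (g 0) (suc i) * ∏< k' (λ j → rising (g (suc j)) (suc i))   ≈⟨ *-cong (rising-first i (g 0)) common ⟩
        (g 0 * ρ) * (D * R)                                               ∎
      -- the parameters of F_{n-1} are g 1, …, g k, and g k = g 0 + 1
      below : extra n' (suc i) ≈ (D * R) * (ρ * ((g 0 + 1#) + ι i))
      below = begin
        extra n' (suc i)                                                  ≈⟨ ∏-toℕ k (λ j → rising (e n' (suc j)) (suc i)) ⟩
        ∏< k (λ j → rising (e n' (suc j)) (suc i))                        ≈⟨ ∏<-cong k (λ j → rising-cong (suc i) (e-shift n' j)) ⟩
        ∏< k' (λ j → rising (g (suc j)) (suc i)) * rising (g k) (suc i)   ≈⟨ *-cong common (rising-cong (suc i) (e-wrap n 1)) ⟩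
        (D * R) * (ρ * ((g 0 + 1#) + ι i))                                ∎
      Δ-split : Δ₁ k n ≈ g 0 * D
      Δ-split = trans (∏-toℕ k g) (∏<-first k' g)
      -- the parameters of F_{n-k} are g 0 + 1, …, g k' + 1
      lowered : extra d i ≈ ρ * R
      lowered = begin
        extra d i                              ≈⟨ ∏-toℕ k (λ j → rising (e d (suc j)) i) ⟩
        ∏< k (λ j → rising (e d (suc j)) i)    ≈⟨ ∏<-cong k (λ j → rising-cong i (raise j)) ⟩
        ∏< k (λ j → rising (g j + 1#) i)       ≈⟨ ∏<-first k' _ ⟩
        ρ * R                                  ∎
        where
        raise : ∀ j → e d (suc j) ≈ g j + 1#
        raise j = trans (e-lower d (suc j))
          (reflexive (≡.cong (λ N → e N (suc j) + 1#) (≡.sym n≡d+k)))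

    power-step : ∀ i → ι (suc i) * power (suc i) ≈ z * power i
    power-step i = begin
      ι (suc i) * ((z * z ^ i) ÷ ι (suc i !))
        ≈⟨ *-congˡ (*-congˡ (sym (⁻¹-cong (*-≉0 (ι-≉0 (suc i)) i!≉0) (sym (ι-* (suc i) (i !)))))) ⟩
      ι (suc i) * ((z * z ^ i) ÷ (ι (suc i) * ι (i !)))
        ≈⟨ *-congˡ (÷-interchange z (z ^ i) (ι-≉0 (suc i)) i!≉0) ⟩
      ι (suc i) * ((z ÷ ι (suc i)) * power i)     ≈⟨ *-assoc _ _ _ ⟨
      (ι (suc i) * (z ÷ ι (suc i))) * power i     ≈⟨ *-congʳ (*-÷-cancel z (ι-≉0 (suc i))) ⟩
      z * power i                                 ∎
      where
      i!≉0 : ι (i !) ≉0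
      i!≉0 = ι-≉0 (i !) {{ℕP._!≢0 i}}

    term-step : ∀ a b → (∀ s → NotNonPosInt (b s)) → ∀ n' d → suc n' ≡ d ℕ.+ k → ∀ i →
      ι (suc n') * (term a b (suc n') (suc i) - term a b n' (suc i))
        ≈ (((ι k * γ₁ p q a b) * Δ₁ k (suc n')) * z) * term (λ r → a r + 1#) (λ s → b s + 1#) d i
    term-step a b b∉ℤ≤0 n' d n≡d+k i = begin
      ι (suc n') * ((ratio a b (suc i) * extra (suc n') (suc i)) * power (suc i)
                    - (ratio a b (suc i) * extra n' (suc i)) * power (suc i))
        ≈⟨ solve 5 (λ N ρ E₁ E₂ V → N :* ((ρ :* E₁) :* V :- (ρ :* E₂) :* V) := (ρ :* (N :* (E₁ :- E₂))) :* V)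
             refl _ _ _ _ _ ⟩
      (ratio a b (suc i) * (ι (suc n') * (extra (suc n') (suc i) - extra n' (suc i)))) * power (suc i)
        ≈⟨ *-congʳ (*-cong (ratio-step a b b∉ℤ≤0 i) (extra-step n' d n≡d+k i)) ⟩
      ((γ * ratio a' b' i) * (((ι k * Δ) * extra d i) * ι (suc i))) * power (suc i)
        ≈⟨ solve 7 (λ γ' ρ K' Δ' E I V → ((γ' :* ρ) :* (((K' :* Δ') :* E) :* I)) :* V
                                       := ((K' :* γ') :* Δ') :* (ρ :* E) :* (I :* V))
             refl _ _ _ _ _ _ _ ⟩
      ((ι k * γ) * Δ) * (ratio a' b' i * extra d i) * (ι (suc i) * power (suc i))
        ≈⟨ *-congˡ (power-step i) ⟩
      ((ι k * γ) * Δ) * (ratio a' b' i * extra d i) * (z * power i)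
        ≈⟨ solve 4 (λ C T Z V → C :* T :* (Z :* V) := (C :* Z) :* (T :* V)) refl _ _ _ _ ⟩
      (((ι k * γ) * Δ) * z) * term a' b' d i
        ∎
      where
      a' : Fin p → Carrier
      a' r = a r + 1#
      b' : Fin q → Carrier
      b' s = b s + 1#
      γ Δ : Carrier
      γ = γ₁ p q a b
      Δ = Δ₁ k (suc n')

    F-contiguous : ∀ a b → (∀ s → NotNonPosInt (b s)) → ∀ n' d → suc n' ≡ d ℕ.+ k →
      ι (suc n') * (Fℕ k p q a b (suc n') z - Fℕ k p q a b n' z)
        ≈ (((ι k * γ₁ p q a b) * Δ₁ k (suc n')) * z) * Fℕ k p q (λ r → a r + 1#) (λ s → b s + 1#) d z
    F-contiguous a b b∉ℤ≤0 n' d n≡d+k = begin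
      ι n * (Fℕ k p q a b n z - Fℕ k p q a b n' z)
        ≈⟨ *-congˡ (+-cong (Fℕ-extend a b n n (m/n≤m n k))
                           (-‿cong (Fℕ-extend a b n' n (ℕP.≤-trans (m/n≤m n' k) (ℕP.n≤1+n n'))))) ⟩
      ι n * (∑≤ n (term a b n) - ∑≤ n (term a b n'))
        ≈⟨ *-congˡ (∑-- n _ _) ⟨
      ι n * ∑≤ n (λ i → term a b n i - term a b n' i)
        ≈⟨ *-congˡ (∑-first n' _) ⟩
      ι n * ((term a b n 0 - term a b n' 0) + ∑≤ n' (λ i → term a b n (suc i) - term a b n' (suc i)))
        ≈⟨ *-congˡ (trans (+-congʳ (-‿inverseʳ (term a b n 0))) (+-identityˡ _)) ⟩
      ι n * ∑≤ n' (λ i → term a b n (suc i) - term a b n' (suc i))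
        ≈⟨ ∑-*ˡ n' (ι n) _ ⟩
      ∑≤ n' (λ i → ι n * (term a b n (suc i) - term a b n' (suc i)))
        ≈⟨ ∑-cong n' (term-step a b b∉ℤ≤0 n' d n≡d+k) ⟩
      ∑≤ n' (λ i → C * term a' b' d i)
        ≈⟨ ∑-*ˡ n' C _ ⟨
      C * ∑≤ n' (term a' b' d)
        ≈⟨ *-congˡ (Fℕ-extend a' b' d n' (ℕP.≤-trans (m/n≤m d k) d≤n')) ⟨
      C * Fℕ k p q a' b' d z
        ∎
      where
      n : ℕ
      n = suc n'
      a' : Fin p → Carrier
      a' r = a r + 1#
      b' : Fin q → Carrier
      b' s = b s + 1#
      C : Carrier
      C = ((ι k * γ₁ p q a b) * Δ₁ k n) * z
      d≤n' : d ℕ.≤ n'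
      d≤n' = ≡.subst (d ℕ.≤_) (≡.sym (ℕP.suc-injective (≡.trans n≡d+k (ℕP.+-suc d k'))))
                     (ℕP.m≤m+n d k')

    F-below-k : ∀ cs ds n' → suc n' ℕ.< k → Fℕ k p q cs ds (suc n') z ≈ Fℕ k p q cs ds n' z
    F-below-k cs ds n' n<k = reflexive (≡.trans (Fℕ-below-k cs ds (suc n') n<k)
      (≡.sym (Fℕ-below-k cs ds n' (ℕP.<-trans (ℕP.n<1+n n') n<k))))

  power-quotient : ∀ {x} → x ≉0 → ∀ n' d k → suc n' ≡ d ℕ.+ k → (x ^ n') ÷ (x ^ k) ≈ x ^ℤ (+ d -ℤ + 1)
  power-quotient {x} x≉0 n' zero .(suc n') ≡.refl = begin
    x ^ n' * (x * x ^ n') ⁻¹          ≈⟨ *-congˡ (⁻¹-* x≉0 (^-≉0 x≉0 n')) ⟩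
    x ^ n' * (x ⁻¹ * (x ^ n') ⁻¹)     ≈⟨ solve 3 (λ X x' X' → X :* (x' :* X') := x' :* (X :* X'))
                                           refl (x ^ n') (x ⁻¹) ((x ^ n') ⁻¹) ⟩
    x ⁻¹ * (x ^ n' * (x ^ n') ⁻¹)     ≈⟨ *-congˡ (⁻¹-inverse _ (^-≉0 x≉0 n')) ⟩
    x ⁻¹ * 1#                         ∎
  power-quotient {x} x≉0 n' (suc d) k n≡d+k = begin
    (x ^ n') ÷ (x ^ k)           ≡⟨ ≡.cong (λ N → (x ^ N) ÷ (x ^ k)) (ℕP.suc-injective n≡d+k) ⟩
    (x ^ (d ℕ.+ k)) ÷ (x ^ k)    ≈⟨ *-congʳ (^-+ x d k) ⟩
    (x ^ d * x ^ k) ÷ (x ^ k)    ≈⟨ ÷-*-cancel (x ^ d) (^-≉0 x≉0 k) ⟩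
    x ^ d                        ∎

  rearrange : ∀ {A F₁ F₂ Q} → A * (F₂ - F₁) ≈ Q → A * F₁ ≈ A * F₂ - Q
  rearrange {A} {F₁} {F₂} A[F₂-F₁]≈Q = trans
    (solve 3 (λ A F₁ F₂ → A :* F₁ := A :* F₂ :- A :* (F₂ :- F₁)) refl A F₁ F₂)
    (+-congˡ (-‿cong A[F₂-F₁]≈Q))

  module Corollary (p q : ℕ) (a : Fin p → Carrier) (b : Fin q → Carrier)
                   (b∉ℤ≤0 : ∀ s → NotNonPosInt (b s))
                   (k' m n' : ℕ) (x : Carrier) (x≉0 : x ≉0) where
    open ExtraParameters k' using (k)
    open Series k' p q (ι m ÷ (x ^ k))

    -- The statement of the corollary for n = 1 + n', with w standing for n - k.
    Relation : ℤ → Set ℓ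
    Relation w =
      (ι (suc n') * x ^ n') * F k p q a b (+ n') (ι m ÷ (x ^ k))
        ≈ ((ι (suc n') * x ^ n') * F k p q a b (+ suc n') (ι m ÷ (x ^ k)))
          - ((((ι k * ι m) * γ₁ p q a b) * Δ₁ k (suc n')) * x ^ℤ (w -ℤ + 1)
             * F k p q (λ r → a r + 1#) (λ s → b s + 1#) w (ι m ÷ (x ^ k)))

    -- For n ≥ k it is the contiguous relation, multiplied by x^{n-1}.
    relation-nonneg : ∀ d → suc n' ≡ d ℕ.+ k → Relation (+ d)
    relation-nonneg d n≡d+k = rearrange (begin
      (ι (suc n') * x ^ n') * (Fℕ k p q a b (suc n') z - Fℕ k p q a b n' z)
        ≈⟨ solve 3 (λ N X D → (N :* X) :* D := X :* (N :* D)) refl _ _ _ ⟩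
      x ^ n' * (ι (suc n') * (Fℕ k p q a b (suc n') z - Fℕ k p q a b n' z))
        ≈⟨ *-congˡ (F-contiguous a b b∉ℤ≤0 n' d n≡d+k) ⟩
      x ^ n' * ((((ι k * γ) * Δ) * (ι m * (x ^ k) ⁻¹)) * F′)
        ≈⟨ solve 7 (λ X K' γ' Δ' M Y F → X :* ((((K' :* γ') :* Δ') :* (M :* Y)) :* F)
                                       := ((((K' :* M) :* γ') :* Δ') :* (X :* Y)) :* F)
             refl _ _ _ _ _ _ _ ⟩
      ((((ι k * ι m) * γ) * Δ) * ((x ^ n') ÷ (x ^ k))) * F′
        ≈⟨ *-congʳ (*-congˡ (power-quotient x≉0 n' d k n≡d+k)) ⟩
      ((((ι k * ι m) * γ) * Δ) * x ^ℤ (+ d -ℤ + 1)) * F′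
        ∎)
      where
      z γ Δ F′ : Carrier
      z  = ι m ÷ (x ^ k)
      γ  = γ₁ p q a b
      Δ  = Δ₁ k (suc n')
      F′ = Fℕ k p q (λ r → a r + 1#) (λ s → b s + 1#) d z

    -- For n < k both sides reduce to the same value, as F_{n-k} = 0.
    relation-negative : suc n' ℕ.< k → ∀ j → Relation -[1+ j ]
    relation-negative n<k j = rearrange (begin
      (ι (suc n') * x ^ n') * (Fℕ k p q a b (suc n') z - Fℕ k p q a b n' z)
        ≈⟨ *-congˡ (trans (+-congʳ (F-below-k a b n' n<k)) (-‿inverseʳ _)) ⟩
      (ι (suc n') * x ^ n') * 0#                                     ≈⟨ zeroʳ _ ⟩
      0#                                                             ≈⟨ zeroʳ _ ⟨
      (((ι k * ι m) * γ₁ p q a b) * Δ₁ k (suc n')) * x ^ℤ (-[1+ j ] -ℤ + 1) * 0#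
        ∎)
      where
      z : Carrier
      z = ι m ÷ (x ^ k)

corollary1 : ∀ {c ℓ : Level} (K : CharZeroField c ℓ) → let open CharZeroField K in let open Ops K in
    (p q : ℕ) (a : Fin p → Carrier) (b : Fin q → Carrier) →
    (∀ (s : Fin q) (t : ℕ) → ¬ (b s ≈ - ι t)) →
    (k : ℕ) .{{_ : NonZero k}} (m : ℕ) (n : ℕ) .{{_ : NonZero n}} (x : Carrier) →
    ¬ (x ≈ 0#) →
    (ι n * (x ^ (n ∸ 1))) * F k p q a b (+ (n ∸ 1)) (ι m ÷ (x ^ k))
      ≈ ((ι n * (x ^ (n ∸ 1))) * F k p q a b (+ n) (ι m ÷ (x ^ k)))
        - ((((ι k * ι m) * γ₁ p q a b) * Δ₁ k n) * (x ^ℤ ((+ n -ℤ + k) -ℤ + 1))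
             * F k p q (λ r → a r + 1#) (λ s → b s + 1#) (+ n -ℤ + k) (ι m ÷ (x ^ k)))
corollary1 K p q a b b∉ℤ≤0 (suc k') m (suc n') x x≉0 with suc k' ℕ.≤? suc n'
... | yes k≤n rewrite sub-nonneg k≤n =
  relation-nonneg (suc n' ∸ suc k') (≡.sym (ℕP.m∸n+n≡m k≤n))
  where open Corollary K p q a b b∉ℤ≤0 k' m n' x x≉0
... | no k≰n with sub-negative (ℕP.≰⇒> k≰n)
...   | j , n-k≡-[1+j] rewrite n-k≡-[1+j] =
  relation-negative (ℕP.≰⇒> k≰n) j
  where open Corollary K p q a b b∉ℤ≤0 k' m n' x x≉0
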